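{- Let $s=(s_0,s_1,s_2,\dots)$ be an integer sequence with $s_n\ge2$ for all $n\ge1$. For $n\ge0$ let \[ g_{n,s}=\begin{pmatrix} a_{n,s}&b_{n,s}\\ c_{n,s}&d_{n,s}\end{pmatrix}=\mathsf{V}(s_0)\mathsf{V}(s_1)\cdots\mathsf{V}(s_n),\qquad \mathsf{V}(m)=\begin{pmatrix} m&-1\\ 1&0\end{pmatrix}, \] and define $R_n(s)=\frac{a_{n,s}}{c_{n,s}}$, $L_n(s)=\frac{a_{n,s}+b_{n,s}}{c_{n,s}+d_{n,s}}$ and $A_n(s)=(c_{n,s}+d_{n,s})c_{n,s}$. Then for every $n\ge0$, \[ c_{n+1,s}>c_{n,s}>0,\qquad c_{n+1,s}+d_{n+1,s}\ge c_{n,s}+d_{n,s}>0,\qquad d_{n,s}\le0, \] (so in particular $R_n(s),L_n(s)$ are well defined) and \[ R_n(s)-L_n(s)=\frac1{A_n(s)}. \] Moreover, $(A_n(s))_{n\ge0}$ is a strictly increasing sequence of positive integers, $(R_n(s))_{n\ge0}$ is a strictly decreasing sequence of rationals bounded from below, and $(L_n(s))_{n\ge0}$ is a (non-strictly) increasing sequence of rationals bounded from above.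
   Context: $R_n(s)$, $L_n(s)$, $A_n(s)$ are called the $n$-th right convergent, left convergent, and accuracy of $s$, respectively. -}

module Defs where

open import Data.Nat using (ℕ; zero; suc)
open import Data.Integer as ℤ using (ℤ; +_; -[1+_]; +[1+_])
open import Data.Rational as ℚ using (ℚ; 0ℚ)

record Mat2 : Set where
  constructor mat
  field
    a b c d : ℤ
open Mat2 public

_⊗_ : Mat2 → Mat2 → Mat2
mat a₁ b₁ c₁ d₁ ⊗ mat a₂ b₂ c₂ d₂ =
  mat (a₁ ℤ.* a₂ ℤ.+ b₁ ℤ.* c₂) (a₁ ℤ.* b₂ ℤ.+ b₁ ℤ.* d₂)
      (c₁ ℤ.* a₂ ℤ.+ d₁ ℤ.* c₂) (c₁ ℤ.* b₂ ℤ.+ d₁ ℤ.* d₂)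

V : ℤ → Mat2
V m = mat m (ℤ.- (+ 1)) (+ 1) (+ 0)

g : ℕ → (ℕ → ℤ) → Mat2
g zero    s = V (s 0)
g (suc n) s = g n s ⊗ V (s (suc n))

-- the rational number p / q; convention: value 0 when q = 0
-- (never used in that case by the theorem, which proves the denominators positive)
frac : ℤ → ℤ → ℚ
frac p (+ zero)    = 0ℚ
frac p +[1+ k ]    = p ℚ./ suc k
frac p -[1+ k ]    = (ℤ.- p) ℚ./ suc k

R : ℕ → (ℕ → ℤ) → ℚ
R n s = frac (a (g n s)) (c (g n s))

L : ℕ → (ℕ → ℤ) → ℚ
L n s = frac (a (g n s) ℤ.+ b (g n s)) (c (g n s) ℤ.+ d (g n s))

A : ℕ → (ℕ → ℤ) → ℤ
A n s = (c (g n s) ℤ.+ d (g n s)) ℤ.* c (g n s)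

module Submission where

open import Defs
open import Data.Nat as ℕ using (ℕ; suc; zero; z≤n; s≤s)
open import Data.Integer as ℤ using (ℤ; +_; +[1+_]; +≤+; +<+; _+_; _*_; _-_; -_)
open import Data.Rational as ℚ using (ℚ)
open import Data.Rational.Unnormalised as ℚᵘ using (mkℚᵘ; *≡*; *≤*; *<*)
open import Data.Product using (_×_; ∃-syntax; _,_)
open import Relation.Binary.PropositionalEquality using (_≡_; refl; sym; trans; cong; cong₂; subst)
open import Data.Integer.Tactic.RingSolver using (solve-∀)
import Data.Integer.Properties as ℤP
import Data.Rational.Properties as ℚP
import Data.Rational.Unnormalised.Properties as ℚᵘP

-- Right multiplication by V(m) sends the columns (x, y) to (m x + y, - x): it preserves
-- the determinant, which is therefore 1, and gives c' = m c + d, d' = - c.  For m ≥ 2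
-- this keeps c > 0, c + d > 0, d ≤ 0, makes c grow strictly and c + d weakly, hence A
-- grow strictly.  Comparing two consecutive convergents by cross-multiplication, the two
-- sides differ by det = 1 (for R_{n+1} < R_n and L_n < R_n) or by (m - 2) det ≥ 0 (for
-- L_n ≤ L_{n+1}); likewise R_n - L_n = det / A_n.  The bounds are L_0 ≤ L_n < R_n ≤ R_0.

toℚᵘ-frac : ∀ p k → ℚ.toℚᵘ (frac p +[1+ k ]) ℚᵘ.≃ mkℚᵘ p k
toℚᵘ-frac p k = ℚP.toℚᵘ-fromℚᵘ (mkℚᵘ p k)

frac-mono-≤ : ∀ {p q r t} → + 0 ℤ.< q → + 0 ℤ.< t → p * t ℤ.≤ r * q → frac p q ℚ.≤ frac r t
frac-mono-≤ {p} {+[1+ k ]} {r} {+[1+ l ]} _ _ cross = ℚP.toℚᵘ-cancel-≤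
  (ℚᵘP.≤-respˡ-≃ (ℚᵘP.≃-sym (toℚᵘ-frac p k)) (ℚᵘP.≤-respʳ-≃ (ℚᵘP.≃-sym (toℚᵘ-frac r l)) (*≤* cross)))
frac-mono-≤ {q = + 0} (+<+ ()) _ _
frac-mono-≤ {q = +[1+ _ ]} {t = + 0} _ (+<+ ()) _

frac-mono-< : ∀ {p q r t} → + 0 ℤ.< q → + 0 ℤ.< t → p * t ℤ.< r * q → frac p q ℚ.< frac r t
frac-mono-< {p} {+[1+ k ]} {r} {+[1+ l ]} _ _ cross = ℚP.toℚᵘ-cancel-<
  (ℚᵘP.<-respˡ-≃ (ℚᵘP.≃-sym (toℚᵘ-frac p k)) (ℚᵘP.<-respʳ-≃ (ℚᵘP.≃-sym (toℚᵘ-frac r l)) (*<* cross)))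
frac-mono-< {q = + 0} (+<+ ()) _ _
frac-mono-< {q = +[1+ _ ]} {t = + 0} _ (+<+ ()) _

frac-sub : ∀ {p q r t} → + 0 ℤ.< q → + 0 ℤ.< t →
           frac p q ℚ.- frac r t ≡ frac (p * t - r * q) (q * t)
frac-sub {p} {+[1+ k ]} {r} {+[1+ l ]} _ _ = ℚP.toℚᵘ-injective (begin
  ℚ.toℚᵘ (frac p +[1+ k ] ℚ.- frac r +[1+ l ])
    ≈⟨ ℚP.toℚᵘ-homo-+ (frac p +[1+ k ]) (ℚ.- frac r +[1+ l ]) ⟩
  ℚ.toℚᵘ (frac p +[1+ k ]) ℚᵘ.+ ℚ.toℚᵘ (ℚ.- frac r +[1+ l ])
    ≈⟨ ℚᵘP.+-cong (toℚᵘ-frac p k)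
         (ℚᵘP.≃-trans (ℚP.toℚᵘ-homo‿- (frac r +[1+ l ])) (ℚᵘP.-‿cong (toℚᵘ-frac r l))) ⟩
  mkℚᵘ p k ℚᵘ.- mkℚᵘ r l
    ≈⟨ *≡* (cong (λ x → (p * +[1+ l ] + x) * +[1+ j ]) (sym (ℤP.neg-distribˡ-* r +[1+ k ]))) ⟩
  mkℚᵘ (p * +[1+ l ] - r * +[1+ k ]) j
    ≈⟨ ℚᵘP.≃-sym (toℚᵘ-frac (p * +[1+ l ] - r * +[1+ k ]) j) ⟩
  ℚ.toℚᵘ (frac (p * +[1+ l ] - r * +[1+ k ]) (+[1+ k ] * +[1+ l ])) ∎)
  where
  open ℚᵘP.≃-Reasoning
  j : ℕ
  j = l ℕ.+ k ℕ.* suc l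
frac-sub {q = + 0} (+<+ ()) _
frac-sub {q = +[1+ _ ]} {t = + 0} _ (+<+ ())

i<i+j : ∀ i {j} → + 0 ℤ.< j → i ℤ.< i + j
i<i+j i {j} j>0 = ℤP.≤-<-trans (ℤP.≤-reflexive (sym (ℤP.+-identityʳ i))) (ℤP.+-monoʳ-< i j>0)

i≤i+j : ∀ i {j} → + 0 ℤ.≤ j → i ℤ.≤ i + j
i≤i+j i {j} j≥0 = ℤP.i≤i+j i j {{ℤ.nonNegative j≥0}}

0≤i*j : ∀ {i j} → + 0 ℤ.≤ i → + 0 ℤ.≤ j → + 0 ℤ.≤ i * j
0≤i*j {i} {j} i≥0 j≥0 = ℤP.*-monoʳ-≤-nonNeg j {{ℤ.nonNegative j≥0}} i≥0

0<i*j : ∀ {i j} → + 0 ℤ.< i → + 0 ℤ.< j → + 0 ℤ.< i * j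
0<i*j {i} {j} i>0 j>0 = ℤP.*-monoʳ-<-pos j {{ℤ.positive j>0}} i>0

*-mono-≤-< : ∀ {i i′ j j′} → + 0 ℤ.< i′ → + 0 ℤ.≤ j → i ℤ.≤ i′ → j ℤ.< j′ → i * j ℤ.< i′ * j′
*-mono-≤-< {i} {i′} {j} {j′} i′>0 j≥0 i≤i′ j<j′ = ℤP.≤-<-trans
  (ℤP.*-monoʳ-≤-nonNeg j {{ℤ.nonNegative j≥0}} i≤i′)
  (ℤP.*-monoˡ-<-pos i′ {{ℤ.positive i′>0}} j<j′)

det : Mat2 → ℤ
det M = a M * d M - b M * c M

right : Mat2 → ℚ
right M = frac (a M) (c M)

left : Mat2 → ℚ
left M = frac (a M + b M) (c M + d M)

accuracy : Mat2 → ℤ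
accuracy M = (c M + d M) * c M

mat-cong : ∀ {a₁ b₁ c₁ d₁ a₂ b₂ c₂ d₂} → a₁ ≡ a₂ → b₁ ≡ b₂ → c₁ ≡ c₂ → d₁ ≡ d₂ →
           mat a₁ b₁ c₁ d₁ ≡ mat a₂ b₂ c₂ d₂
mat-cong refl refl refl refl = refl

⊗V-columns : ∀ M m → M ⊗ V m ≡ mat (a M * m + b M) (- a M) (c M * m + d M) (- c M)
⊗V-columns M m = mat-cong
  (cong (λ x → a M * m + x) (ℤP.*-identityʳ (b M))) (column₂ (a M) (b M))
  (cong (λ x → c M * m + x) (ℤP.*-identityʳ (d M))) (column₂ (c M) (d M))
  where
  column₂ : ∀ x y → x * - + 1 + y * + 0 ≡ - x
  column₂ = solve-∀

det-V : ∀ m → det (V m) ≡ + 1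
det-V m = identity m
  where
  identity : ∀ m → m * + 0 - - + 1 * + 1 ≡ + 1
  identity = solve-∀

det-⊗V : ∀ M m → det (M ⊗ V m) ≡ det M
det-⊗V M m = trans (cong det (⊗V-columns M m)) (identity (a M) (b M) (c M) (d M) m)
  where
  identity : ∀ a b c d m → (a * m + b) * - c - - a * (c * m + d) ≡ a * d - b * c
  identity = solve-∀

left-right-cross : ∀ M → a M * (c M + d M) ≡ (a M + b M) * c M + det M
left-right-cross M = identity (a M) (b M) (c M) (d M)
  where
  identity : ∀ a b c d → a * (c + d) ≡ (a + b) * c + (a * d - b * c)
  identity = solve-∀

right-⊗V-cross : ∀ M m → a M * c (M ⊗ V m) ≡ a (M ⊗ V m) * c M + det M
right-⊗V-cross M m = subst (λ N → a M * c N ≡ a N * c M + det M) (sym (⊗V-columns M m))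
  (identity (a M) (b M) (c M) (d M) m)
  where
  identity : ∀ a b c d m → a * (c * m + d) ≡ (a * m + b) * c + (a * d - b * c)
  identity = solve-∀

left-⊗V-cross : ∀ M m →
  (a (M ⊗ V m) + b (M ⊗ V m)) * (c M + d M)
    ≡ (a M + b M) * (c (M ⊗ V m) + d (M ⊗ V m)) + (m - + 2) * det M
left-⊗V-cross M m =
  subst (λ N → (a N + b N) * (c M + d M) ≡ (a M + b M) * (c N + d N) + (m - + 2) * det M)
    (sym (⊗V-columns M m)) (identity (a M) (b M) (c M) (d M) m)
  where
  identity : ∀ a b c d m →
    (a * m + b + - a) * (c + d) ≡ (a + b) * (c * m + d + - c) + (m - + 2) * (a * d - b * c)
  identity = solve-∀

c-⊗V : ∀ M m → c (M ⊗ V m) ≡ c M + (c M * (m - + 2) + (c M + d M))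
c-⊗V M m = trans (cong c (⊗V-columns M m)) (identity (c M) (d M) m)
  where
  identity : ∀ c d m → c * m + d ≡ c + (c * (m - + 2) + (c + d))
  identity = solve-∀

c+d-⊗V : ∀ M m → c (M ⊗ V m) + d (M ⊗ V m) ≡ (c M + d M) + c M * (m - + 2)
c+d-⊗V M m = trans (cong (λ N → c N + d N) (⊗V-columns M m)) (identity (c M) (d M) m)
  where
  identity : ∀ c d m → c * m + d + - c ≡ (c + d) + c * (m - + 2)
  identity = solve-∀

record Admissible (M : Mat2) : Set where
  field
    c-pos    : + 0 ℤ.< c M
    c+d-pos  : + 0 ℤ.< c M + d M
    d-nonpos : d M ℤ.≤ + 0
open Admissible

admissible-V : ∀ m → Admissible (V m)
admissible-V m = record { c-pos = +<+ (s≤s z≤n) ; c+d-pos = +<+ (s≤s z≤n) ; d-nonpos = +≤+ z≤n }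

module _ {M : Mat2} {m : ℤ} (adm : Admissible M) (m≥2 : + 2 ℤ.≤ m) where

  private
    c[m-2]≥0 : + 0 ℤ.≤ c M * (m - + 2)
    c[m-2]≥0 = 0≤i*j (ℤP.<⇒≤ (c-pos adm)) (ℤP.i≤j⇒0≤j-i m≥2)

  c-⊗V-increasing : c M ℤ.< c (M ⊗ V m)
  c-⊗V-increasing rewrite c-⊗V M m =
    i<i+j (c M) (ℤP.≤-<-trans c[m-2]≥0 (i<i+j _ (c+d-pos adm)))

  c+d-⊗V-monotone : c M + d M ℤ.≤ c (M ⊗ V m) + d (M ⊗ V m)
  c+d-⊗V-monotone rewrite c+d-⊗V M m = i≤i+j (c M + d M) c[m-2]≥0

  admissible-⊗V : Admissible (M ⊗ V m)
  admissible-⊗V = record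
    { c-pos    = ℤP.<-trans (c-pos adm) c-⊗V-increasing
    ; c+d-pos  = ℤP.<-≤-trans (c+d-pos adm) c+d-⊗V-monotone
    ; d-nonpos = ℤP.≤-trans (ℤP.≤-reflexive (cong d (⊗V-columns M m)))
                            (ℤP.neg-mono-≤ (ℤP.<⇒≤ (c-pos adm)))
    }

  accuracy-⊗V-increasing : accuracy M ℤ.< accuracy (M ⊗ V m)
  accuracy-⊗V-increasing = *-mono-≤-< (c+d-pos admissible-⊗V) (ℤP.<⇒≤ (c-pos adm))
    c+d-⊗V-monotone c-⊗V-increasing

  right-⊗V-decreasing : + 0 ℤ.< det M → right (M ⊗ V m) ℚ.< right M
  right-⊗V-decreasing det>0 = frac-mono-< (c-pos admissible-⊗V) (c-pos adm)
    (ℤP.<-≤-trans (i<i+j _ det>0) (ℤP.≤-reflexive (sym (right-⊗V-cross M m))))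

  left-⊗V-increasing : + 0 ℤ.≤ det M → left M ℚ.≤ left (M ⊗ V m)
  left-⊗V-increasing det≥0 = frac-mono-≤ (c+d-pos adm) (c+d-pos admissible-⊗V)
    (ℤP.≤-trans (i≤i+j _ (0≤i*j (ℤP.i≤j⇒0≤j-i m≥2) det≥0))
                (ℤP.≤-reflexive (sym (left-⊗V-cross M m))))

accuracy-pos : ∀ {M} → Admissible M → + 0 ℤ.< accuracy M
accuracy-pos adm = 0<i*j (c+d-pos adm) (c-pos adm)

left<right : ∀ {M} → Admissible M → + 0 ℤ.< det M → left M ℚ.< right M
left<right {M} adm det>0 = frac-mono-< (c+d-pos adm) (c-pos adm)
  (ℤP.<-≤-trans (i<i+j _ det>0) (ℤP.≤-reflexive (sym (left-right-cross M))))

right-left : ∀ {M} → Admissible M → right M ℚ.- left M ≡ frac (det M) (accuracy M)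
right-left {M} adm = trans (frac-sub (c-pos adm) (c+d-pos adm))
  (cong₂ frac (identity (a M) (b M) (c M) (d M)) (ℤP.*-comm (c M) (c M + d M)))
  where
  identity : ∀ a b c d → a * (c + d) - (a + b) * c ≡ a * d - b * c
  identity = solve-∀

det-g : ∀ n s → det (g n s) ≡ + 1
det-g zero    s = det-V (s 0)
det-g (suc n) s = trans (det-⊗V (g n s) (s (suc n))) (det-g n s)

module _ (s : ℕ → ℤ) (s≥2 : ∀ n → 1 ℕ.≤ n → + 2 ℤ.≤ s n) where

  s[1+n]≥2 : ∀ n → + 2 ℤ.≤ s (suc n)
  s[1+n]≥2 n = s≥2 (suc n) (s≤s z≤n)

  private
    det-g-pos : ∀ n → + 0 ℤ.< det (g n s)
    det-g-pos n rewrite det-g n s = +<+ (s≤s z≤n)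

  admissible-g : ∀ n → Admissible (g n s)
  admissible-g zero    = admissible-V (s 0)
  admissible-g (suc n) = admissible-⊗V (admissible-g n) (s[1+n]≥2 n)

  R-decreasing : ∀ n → R (suc n) s ℚ.< R n s
  R-decreasing n = right-⊗V-decreasing (admissible-g n) (s[1+n]≥2 n) (det-g-pos n)

  L-increasing : ∀ n → L n s ℚ.≤ L (suc n) s
  L-increasing n = left-⊗V-increasing (admissible-g n) (s[1+n]≥2 n) (ℤP.<⇒≤ (det-g-pos n))

  L<R : ∀ n → L n s ℚ.< R n s
  L<R n = left<right (admissible-g n) (det-g-pos n)

  R≤R₀ : ∀ n → R n s ℚ.≤ R 0 s
  R≤R₀ zero    = ℚP.≤-refl
  R≤R₀ (suc n) = ℚP.≤-trans (ℚP.<⇒≤ (R-decreasing n)) (R≤R₀ n)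

  L₀≤L : ∀ n → L 0 s ℚ.≤ L n s
  L₀≤L zero    = ℚP.≤-refl
  L₀≤L (suc n) = ℚP.≤-trans (L₀≤L n) (L-increasing n)

  R-L : ∀ n → R n s ℚ.- L n s ≡ frac (+ 1) (A n s)
  R-L n = trans (right-left (admissible-g n)) (cong (λ δ → frac δ (A n s)) (det-g n s))

theorem1 : (s : ℕ → ℤ) → (∀ n → 1 ℕ.≤ n → + 2 ℤ.≤ s n) →
    (∀ n →
        (c (g (suc n) s) ℤ.> c (g n s)) × (c (g n s) ℤ.> + 0)
      × (c (g (suc n) s) ℤ.+ d (g (suc n) s) ℤ.≥ c (g n s) ℤ.+ d (g n s))
      × (c (g n s) ℤ.+ d (g n s) ℤ.> + 0)
      × (d (g n s) ℤ.≤ + 0)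
      × (R n s ℚ.- L n s ≡ frac (+ 1) (A n s)))
    × (∀ n → A n s ℤ.< A (suc n) s) × (∀ n → + 0 ℤ.< A n s)
    × (∀ n → R (suc n) s ℚ.< R n s) × (∃[ q ] (∀ n → q ℚ.≤ R n s))
    × (∀ n → L n s ℚ.≤ L (suc n) s) × (∃[ q ] (∀ n → L n s ℚ.≤ q))
theorem1 s s≥2 =
    (λ n → c-⊗V-increasing (adm n) (step n) , c-pos (adm n)
         , c+d-⊗V-monotone (adm n) (step n) , c+d-pos (adm n)
         , d-nonpos (adm n) , R-L s s≥2 n)
  , (λ n → accuracy-⊗V-increasing (adm n) (step n)) , (λ n → accuracy-pos (adm n))
  , R-decreasing s s≥2
  , (L 0 s , λ n → ℚP.≤-trans (L₀≤L s s≥2 n) (ℚP.<⇒≤ (L<R s s≥2 n)))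
  , L-increasing s s≥2
  , (R 0 s , λ n → ℚP.≤-trans (ℚP.<⇒≤ (L<R s s≥2 n)) (R≤R₀ s s≥2 n))
  where
  adm : ∀ n → Admissible (g n s)
  adm = admissible-g s s≥2
  step : ∀ n → + 2 ℤ.≤ s (suc n)
  step = s[1+n]≥2 s s≥2
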